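{- Let $\mathrm{stat}$ be a Mahonian statistic on set partitions, i.e. $\mathrm{lb}$ or any statistic equidistributed with $\mathrm{lb}$ on $\Pi_n$ for every $n$. Then $\mathrm{stat}$ exhibits the cyclic sieving phenomenon with respect to involutions on $\Pi_n$ having $b_n$ fixed points, where $\sum_{n\ge0}b_nt^n=1/(1-t-t^2)$ (so $b_n=1,1,2,3,5,\dots$).
   Context: $\Pi_n$ is the set of set partitions of $[n]$. For $\pi\in\Pi_n$, $\mathrm{lb}(\pi)=\#\{(B_1,B_2,k):B_1,B_2\text{ blocks of }\pi,\ k\in B_1,\ \min B_1<\min B_2<k\}$. Cyclic sieving for involutions: for an involution $\phi$ on a finite set $X$ and polynomial $f$, $(X,\{\mathrm{id},\phi\},f)$ exhibits the CSP iff $f(1)=|X|$ and $f(-1)$ equals the number of fixed points of $\phi$; a statistic exhibits the CSP with respect to involutions having $b_n$ fixed points if for every $n\ge0$ and every involution $\phi$ of $\Pi_n$ with exactly $b_n$ fixed points, $(\Pi_n,\{\mathrm{id},\phi\},\sum_{\pi\in\Pi_n}q^{\mathrm{stat}(\pi)})$ exhibits the CSP. -}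

module Defs where

open import Data.Nat using (ℕ; zero; suc; _+_; _<_; _≤ᵇ_; _≡ᵇ_)
open import Data.Nat.Properties as ℕP using (_<?_)
open import Data.Integer as ℤ using (ℤ; +_; -[1+_])
open import Data.Bool using (Bool; true; false; T; if_then_else_; _∧_)
open import Data.Unit using (tt)
open import Data.Fin using (Fin; toℕ)
open import Data.Vec using (Vec; []; _∷_; lookup)
open import Data.Vec.Properties as VecP using ()
open import Data.List using (List; []; _∷_; [_]; map; concatMap; upTo; allFin; mapMaybe; filter; length; foldr)
open import Data.Maybe using (Maybe; just; nothing)
open import Data.Product using (Σ; _×_; _,_; proj₁; proj₂)
open import Relation.Nullary using (Dec; yes; no; ¬_)
open import Relation.Nullary.Decidable using (T?; _×-dec_; map′)
open import Relation.Binary.PropositionalEquality using (_≡_; refl; cong)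

-- Set partitions of [n] = {1,…,n}, encoded canonically by restricted
-- growth words w = w₀ … w_{n-1}: element i+1 lies in block number wᵢ,
-- where blocks are numbered 0,1,2,… in increasing order of their minima.

-- rgfFrom c w : the word w is a valid continuation when c blocks are open
rgfFrom : ∀ {k} → ℕ → Vec ℕ k → Bool
rgfFrom c [] = true
rgfFrom c (x ∷ xs) = (x ≤ᵇ c) ∧ rgfFrom (if x ≡ᵇ c then suc c else c) xs

isRGF : ∀ {n} → Vec ℕ n → Bool
isRGF w = rgfFrom 0 w

nBlocksFrom : ∀ {k} → ℕ → Vec ℕ k → ℕ
nBlocksFrom c [] = c
nBlocksFrom c (x ∷ xs) = nBlocksFrom (if x ≡ᵇ c then suc c else c) xs

nBlocks : ∀ {n} → Vec ℕ n → ℕ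
nBlocks w = nBlocksFrom 0 w

SetPartition : ℕ → Set
SetPartition n = Σ (Vec ℕ n) (λ w → T (isRGF w))

T-irr : ∀ {b} (p q : T b) → p ≡ q
T-irr {true} tt tt = refl

_≟SP_ : ∀ {n} (π σ : SetPartition n) → Dec (π ≡ σ)
(w , p) ≟SP (v , q) with VecP.≡-dec ℕP._≟_ w v
... | no ne = no (λ e → ne (cong proj₁ e))
... | yes refl with T-irr p q
...   | refl = yes refl

allWords : (n b : ℕ) → List (Vec ℕ n)
allWords zero b = [ [] ]
allWords (suc n) b = concatMap (λ x → map (x ∷_) (allWords n b)) (upTo b)

toSP : ∀ {n} → Vec ℕ n → Maybe (SetPartition n)
toSP w with T? (isRGF w)
... | yes p = just (w , p)
... | no _ = nothing

Π : (n : ℕ) → List (SetPartition n)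
Π n = mapMaybe toSP (allWords n n)

-- The statistic lb.
-- min of block j (positions 0-based); returns n if block j is empty
minBlock : ∀ {n} → Vec ℕ n → ℕ → ℕ
minBlock [] j = 0
minBlock (x ∷ xs) j = if x ≡ᵇ j then 0 else suc (minBlock xs j)

lb : ∀ {n} → SetPartition n → ℕ
lb {n} (w , _) = length (filter cond triples)
  where
  triples : List (ℕ × ℕ × Fin n)
  triples = concatMap (λ j₁ → concatMap (λ j₂ → map (λ k → j₁ , j₂ , k) (allFin n))
                                         (upTo (nBlocks w)))
                      (upTo (nBlocks w))
  cond : (t : ℕ × ℕ × Fin n) → Dec ((lookup w (proj₂ (proj₂ t)) ≡ proj₁ t)
                                    × (minBlock w (proj₁ t) < minBlock w (proj₁ (proj₂ t)))
                                    × (minBlock w (proj₁ (proj₂ t)) < toℕ (proj₂ (proj₂ t))))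
  cond (j₁ , j₂ , k) = (lookup w k ℕP.≟ j₁) ×-dec ((minBlock w j₁ <? minBlock w j₂)
                                           ×-dec (minBlock w j₂ <? toℕ k))

Statistic : Set
Statistic = ∀ {n} → SetPartition n → ℕ

count : ∀ {n} → (SetPartition n → ℕ) → ℕ → ℕ
count {n} f k = length (filter (λ π → f π ℕP.≟ k) (Π n))

EquidistributedWithLb : Statistic → Set
EquidistributedWithLb stat = ∀ n k → count {n} stat k ≡ count {n} lb k

IsInvolution : ∀ {n} → (SetPartition n → SetPartition n) → Set
IsInvolution {n} φ = ∀ (π : SetPartition n) → φ (φ π) ≡ π

numFixedPoints : ∀ {n} → (SetPartition n → SetPartition n) → ℕ
numFixedPoints {n} φ = length (filter (λ π → φ π ≟SP π) (Π n))

genFunEval : ∀ {n} → (SetPartition n → ℕ) → ℤ → ℤ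
genFunEval {n} stat q = foldr (λ π acc → (q ℤ.^ stat π) ℤ.+ acc) (+ 0) (Π n)

-- (Π_n, {id, φ}, f) exhibits the CSP: f(1) = |Π_n| and f(-1) = #fixed points of φ
CSP-involution : ∀ {n} → (SetPartition n → SetPartition n) → (SetPartition n → ℕ) → Set
CSP-involution {n} φ stat =
  (genFunEval stat (+ 1) ≡ + length (Π n)) × (genFunEval stat (-[1+ 0 ]) ≡ + numFixedPoints φ)

b : ℕ → ℕ
b zero = 1
b (suc zero) = 1
b (suc (suc n)) = b (suc n) + b n

{-# OPTIONS --safe #-}
module Submission where

-- By equidistribution, f(-1) = Σ_π (-1)^stat(π) may be computed with lb instead of stat, and
-- f(1) = |Π_n| is immediate.  Read the restricted growth word of π from left to right: when c blocks
-- are already open, a letter x contributes c - 1 - x to lb (one for each block opened after block x).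
-- Hence the signed sum F(c, m) over all continuations of length m from c open blocks satisfies
--   F(c, m + 1) = A(c) F(c, m) + F(c + 1, m),   where A(c) = Σ_{x<c} (-1)^(c-1-x) = [c odd],
-- so F(c, m) = b_{m+1} for odd c and F(c, m) = b_m for even c.  In particular Σ_π (-1)^lb(π) = F(0, n) = b_n.

open import Algebra.Bundles using (Semiring)
open import Data.Bool.Base using (Bool; true; false; T; not; if_then_else_)
open import Data.List.Base
  using (List; []; _∷_; [_]; _++_; map; concatMap; mapMaybe; filter; foldr; length; upTo; applyUpTo; tabulate; allFin)
open import Data.List.Extrema.Nat using (max; xs≤max)
open import Data.List.Membership.Propositional using (_∈_)
open import Data.List.Membership.Propositional.Properties using (∈-map⁺; ∈-upTo⁻)
open import Data.List.Properties using (map-upTo; upTo-∷ʳ; map-tabulate)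
open import Data.List.Relation.Unary.All as All using ()
open import Data.List.Relation.Unary.Any using (here; there)
open import Data.Maybe.Base using (Maybe; just; nothing; maybe′)
open import Data.Nat.Base using (ℕ; zero; suc; _∸_; _⊔_; _<_; _≤_; z≤n; s≤s; z<s)
import Data.Nat.Properties as ℕₚ
open import Data.Product.Base using (_×_; _,_; proj₁)
open import Data.Sum.Base using (inj₁; inj₂)
open import Function.Base using (_∘_; id)
open import Level using (Level)
open import Relation.Binary.PropositionalEquality as ≡ using (_≡_)
open import Relation.Nullary.Decidable using (Dec; yes; no; does; _×-dec_)
open import Relation.Unary using (Pred; Decidable)

module FiniteSums {c ℓ} (R : Semiring c ℓ) where

  open Semiring R
    using (Carrier; _≈_; _+_; _*_; 0#; setoid; refl; sym; trans;
           +-cong; +-congˡ; +-assoc; +-identityˡ; +-identityʳ;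
           distribˡ; distribʳ; zeroˡ; zeroʳ; +-commutativeSemigroup)
  open import Algebra.Properties.CommutativeSemigroup +-commutativeSemigroup using (interchange)
  open import Relation.Binary.Reasoning.Setoid setoid

  private variable
    p : Level
    A B : Set
    g h : A → Carrier

  ∑ : List A → (A → Carrier) → Carrier
  ∑ xs g = foldr (λ x s → g x + s) 0# xs

  syntax ∑ xs (λ x → e) = ∑[ x ∈ xs ] e

  ∑-cong-∈ : ∀ (xs : List A) → (∀ {x} → x ∈ xs → g x ≈ h x) → ∑ xs g ≈ ∑ xs h
  ∑-cong-∈ []       _  = refl
  ∑-cong-∈ (x ∷ xs) eq = +-cong (eq (here ≡.refl)) (∑-cong-∈ xs (eq ∘ there))

  ∑-cong : ∀ (xs : List A) → (∀ x → g x ≈ h x) → ∑ xs g ≈ ∑ xs h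
  ∑-cong xs eq = ∑-cong-∈ xs (λ {x} _ → eq x)

  ∑-zero : ∀ (xs : List A) → ∑[ _ ∈ xs ] 0# ≈ 0#
  ∑-zero []       = refl
  ∑-zero (_ ∷ xs) = trans (+-identityˡ _) (∑-zero xs)

  ∑-++ : ∀ (xs ys : List A) → ∑ (xs ++ ys) g ≈ ∑ xs g + ∑ ys g
  ∑-++ []       ys = sym (+-identityˡ _)
  ∑-++ (x ∷ xs) ys = trans (+-congˡ (∑-++ xs ys)) (sym (+-assoc _ _ _))

  ∑-map : ∀ (f : B → A) xs → ∑ (map f xs) g ≈ ∑[ x ∈ xs ] g (f x)
  ∑-map f []       = refl
  ∑-map f (x ∷ xs) = +-congˡ (∑-map f xs)

  ∑-concatMap : ∀ (f : B → List A) xs → ∑ (concatMap f xs) g ≈ ∑[ x ∈ xs ] ∑ (f x) g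
  ∑-concatMap f []       = refl
  ∑-concatMap f (x ∷ xs) = trans (∑-++ (f x) _) (+-congˡ (∑-concatMap f xs))

  ∑-mapMaybe : ∀ (f : B → Maybe A) xs → ∑ (mapMaybe f xs) g ≈ ∑[ x ∈ xs ] maybe′ g 0# (f x)
  ∑-mapMaybe f []       = refl
  ∑-mapMaybe f (x ∷ xs) with f x
  ... | just _  = +-congˡ (∑-mapMaybe f xs)
  ... | nothing = trans (∑-mapMaybe f xs) (sym (+-identityˡ _))

  ∑-filter : ∀ {P : Pred A p} (P? : Decidable P) xs →
             ∑ (filter P? xs) g ≈ ∑[ x ∈ xs ] (if does (P? x) then g x else 0#)
  ∑-filter P? []       = refl
  ∑-filter P? (x ∷ xs) with does (P? x)
  ... | true  = +-congˡ (∑-filter P? xs)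
  ... | false = trans (∑-filter P? xs) (sym (+-identityˡ _))

  ∑-distrib-+ : ∀ (xs : List A) → ∑[ x ∈ xs ] (g x + h x) ≈ ∑ xs g + ∑ xs h
  ∑-distrib-+ []       = sym (+-identityˡ 0#)
  ∑-distrib-+ {g = g} {h = h} (x ∷ xs) = begin
    (g x + h x) + ∑[ y ∈ xs ] (g y + h y) ≈⟨ +-congˡ (∑-distrib-+ xs) ⟩
    (g x + h x) + (∑ xs g + ∑ xs h)       ≈⟨ interchange _ _ _ _ ⟩
    (g x + ∑ xs g) + (h x + ∑ xs h)       ∎

  ∑-comm : ∀ (xs : List A) (ys : List B) (g : A → B → Carrier) →
           ∑[ x ∈ xs ] ∑[ y ∈ ys ] g x y ≈ ∑[ y ∈ ys ] ∑[ x ∈ xs ] g x y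
  ∑-comm []       ys g = sym (∑-zero ys)
  ∑-comm (x ∷ xs) ys g = begin
    ∑[ y ∈ ys ] g x y + ∑[ x′ ∈ xs ] ∑[ y ∈ ys ] g x′ y ≈⟨ +-congˡ (∑-comm xs ys g) ⟩
    ∑[ y ∈ ys ] g x y + ∑[ y ∈ ys ] ∑[ x′ ∈ xs ] g x′ y ≈⟨ sym (∑-distrib-+ ys) ⟩
    ∑[ y ∈ ys ] (g x y + ∑[ x′ ∈ xs ] g x′ y)           ∎

  *-distribˡ-∑ : ∀ a (xs : List A) → a * ∑ xs g ≈ ∑[ x ∈ xs ] (a * g x)
  *-distribˡ-∑ a []       = zeroʳ a
  *-distribˡ-∑ a (x ∷ xs) = trans (distribˡ a _ _) (+-congˡ (*-distribˡ-∑ a xs))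

  *-distribʳ-∑ : ∀ a (xs : List A) → ∑ xs g * a ≈ ∑[ x ∈ xs ] (g x * a)
  *-distribʳ-∑ a []       = zeroˡ a
  *-distribʳ-∑ a (x ∷ xs) = trans (distribʳ a _ _) (+-congˡ (*-distribʳ-∑ a xs))

  ∑-const-cong : ∀ (xs : List A) (ys : List B) {a} → length xs ≡ length ys →
                 ∑[ _ ∈ xs ] a ≈ ∑[ _ ∈ ys ] a
  ∑-const-cong []       []       _  = refl
  ∑-const-cong (_ ∷ xs) (_ ∷ ys) eq = +-congˡ (∑-const-cong xs ys (ℕₚ.suc-injective eq))

  ∑-upTo-suc : ∀ n (g : ℕ → Carrier) → ∑[ i ∈ upTo (suc n) ] g i ≈ g 0 + ∑[ i ∈ upTo n ] g (suc i)
  ∑-upTo-suc n g = +-congˡ (begin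
    ∑ (applyUpTo suc n) g     ≡⟨ ≡.cong (λ is → ∑ is g) (≡.sym (map-upTo suc n)) ⟩
    ∑ (map suc (upTo n)) g    ≈⟨ ∑-map suc (upTo n) ⟩
    ∑[ i ∈ upTo n ] g (suc i) ∎)

  ∑-upTo-∷ʳ : ∀ n (g : ℕ → Carrier) → ∑[ i ∈ upTo (suc n) ] g i ≈ ∑[ i ∈ upTo n ] g i + g n
  ∑-upTo-∷ʳ n g = begin
    ∑ (upTo (suc n)) g        ≡⟨ ≡.cong (λ is → ∑ is g) (≡.sym (upTo-∷ʳ n)) ⟩
    ∑ (upTo n ++ [ n ]) g     ≈⟨ ∑-++ (upTo n) [ n ] ⟩
    ∑ (upTo n) g + (g n + 0#) ≈⟨ +-congˡ (+-identityʳ (g n)) ⟩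
    ∑ (upTo n) g + g n        ∎

  ∑-upTo-vanishing : ∀ {m n} (g : ℕ → Carrier) → m ≤ n → (∀ {i} → m ≤ i → i < n → g i ≈ 0#) →
                     ∑[ i ∈ upTo n ] g i ≈ ∑[ i ∈ upTo m ] g i
  ∑-upTo-vanishing {n = zero} g z≤n _ = refl
  ∑-upTo-vanishing {m} {suc n} g m≤1+n vanish with ℕₚ.m≤n⇒m<n∨m≡n m≤1+n
  ... | inj₂ ≡.refl = refl
  ... | inj₁ m<1+n  = begin
    ∑ (upTo (suc n)) g  ≈⟨ ∑-upTo-∷ʳ n g ⟩
    ∑ (upTo n) g + g n  ≈⟨ +-congˡ (vanish m≤n (ℕₚ.n<1+n n)) ⟩
    ∑ (upTo n) g + 0#   ≈⟨ +-identityʳ _ ⟩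
    ∑ (upTo n) g        ≈⟨ ∑-upTo-vanishing g m≤n (λ m≤i i<n → vanish m≤i (ℕₚ.m<n⇒m<1+n i<n)) ⟩
    ∑ (upTo m) g        ∎
    where
    m≤n : m ≤ n
    m≤n = ℕₚ.m<1+n⇒m≤n m<1+n

  ∑-δ : ∀ {x n} (g : ℕ → Carrier) → x < n →
        ∑[ j ∈ upTo n ] (if does (x ℕₚ.≟ j) then g j else 0#) ≈ g x
  ∑-δ {zero} {suc n} g _ = begin
    ∑[ j ∈ upTo (suc n) ] (if does (0 ℕₚ.≟ j) then g j else 0#) ≈⟨ ∑-upTo-suc n _ ⟩
    g 0 + ∑[ _ ∈ upTo n ] 0#                                  ≈⟨ +-congˡ (∑-zero (upTo n)) ⟩
    g 0 + 0#                                                  ≈⟨ +-identityʳ (g 0) ⟩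
    g 0                                                       ∎
  ∑-δ {suc x} {suc n} g (s≤s x<n) =
    trans (∑-upTo-suc n _) (trans (+-identityˡ _) (∑-δ (g ∘ suc) x<n))

  ∑-fibres : ∀ (xs : List A) (f : A → ℕ) (h : ℕ → Carrier) {M} → (∀ {x} → x ∈ xs → f x < M) →
             ∑[ x ∈ xs ] h (f x) ≈ ∑[ k ∈ upTo M ] ∑[ _ ∈ filter (λ x → f x ℕₚ.≟ k) xs ] h k
  ∑-fibres xs f h {M} bounded = begin
    ∑[ x ∈ xs ] h (f x)
      ≈⟨ ∑-cong-∈ xs (λ x∈xs → sym (∑-δ h (bounded x∈xs))) ⟩
    ∑[ x ∈ xs ] ∑[ k ∈ upTo M ] (if does (f x ℕₚ.≟ k) then h k else 0#)
      ≈⟨ ∑-comm xs (upTo M) _ ⟩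
    ∑[ k ∈ upTo M ] ∑[ x ∈ xs ] (if does (f x ℕₚ.≟ k) then h k else 0#)
      ≈⟨ ∑-cong (upTo M) (λ k → sym (∑-filter (λ x → f x ℕₚ.≟ k) xs)) ⟩
    ∑[ k ∈ upTo M ] ∑[ _ ∈ filter (λ x → f x ℕₚ.≟ k) xs ] h k
      ∎

  ∑-equidistributed : ∀ {A : Set} (xs : List A) (f g : A → ℕ) (h : ℕ → Carrier) →
    (∀ k → length (filter (λ x → f x ℕₚ.≟ k) xs) ≡ length (filter (λ x → g x ℕₚ.≟ k) xs)) →
    ∑[ x ∈ xs ] h (f x) ≈ ∑[ x ∈ xs ] h (g x)
  ∑-equidistributed {A} xs f g h same-counts = begin
    ∑[ x ∈ xs ] h (f x)
      ≈⟨ ∑-fibres xs f h f<M ⟩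
    ∑[ k ∈ upTo M ] ∑[ _ ∈ fibre f k ] h k
      ≈⟨ ∑-cong (upTo M) (λ k → ∑-const-cong (fibre f k) (fibre g k) (same-counts k)) ⟩
    ∑[ k ∈ upTo M ] ∑[ _ ∈ fibre g k ] h k
      ≈⟨ sym (∑-fibres xs g h g<M) ⟩
    ∑[ x ∈ xs ] h (g x)
      ∎
    where
    fibre : (A → ℕ) → ℕ → List A
    fibre u k = filter (λ x → u x ℕₚ.≟ k) xs
    maxOf : (A → ℕ) → ℕ
    maxOf u = max 0 (map u xs)
    M : ℕ
    M = suc (maxOf f ⊔ maxOf g)
    ≤maxOf : ∀ u {x} → x ∈ xs → u x ≤ maxOf u
    ≤maxOf u x∈xs = All.lookup (xs≤max 0 (map u xs)) (∈-map⁺ u x∈xs)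
    f<M : ∀ {x} → x ∈ xs → f x < M
    f<M x∈xs = s≤s (ℕₚ.m≤n⇒m≤n⊔o (maxOf g) (≤maxOf f x∈xs))
    g<M : ∀ {x} → x ∈ xs → g x < M
    g<M x∈xs = s≤s (ℕₚ.m≤n⇒m≤o⊔n (maxOf f) (≤maxOf g x∈xs))

open import Defs
open import Data.Bool.Properties using (T-∧)
open import Data.Empty using (⊥-elim)
open import Data.Fin.Base as Fin using (Fin; toℕ)
open import Data.Integer.Base as ℤ using (ℤ; +_; 0ℤ; 1ℤ; -1ℤ; _*_; _^_)
import Data.Integer.Properties as ℤₚ
open import Data.Nat.Base using (_+_; _≡ᵇ_; _≤ᵇ_)
open import Data.Nat.Properties using (_≟_; _<?_; _≤?_)
open import Data.Vec.Base using (Vec; []; _∷_; lookup)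
open import Function.Bundles using (_⇔_; mk⇔; Equivalence)
open import Relation.Binary.Definitions using (tri<; tri≈; tri>)
open import Relation.Binary.PropositionalEquality
  using (_≢_; refl; sym; trans; cong; cong₂; subst; module ≡-Reasoning)
open import Relation.Nullary.Decidable using (T?; dec-true; dec-false; does-⇔)
open import Relation.Nullary.Negation using (¬_)

≡ᵇ-refl : ∀ n → (n ≡ᵇ n) ≡ true
≡ᵇ-refl n = dec-true (n ≟ n) refl

≢⇒≡ᵇ-false : ∀ {m n} → m ≢ n → (m ≡ᵇ n) ≡ false
≢⇒≡ᵇ-false {m} {n} = dec-false (m ≟ n)

minBlock-∷-≡ : ∀ {m} x (xs : Vec ℕ m) → minBlock (x ∷ xs) x ≡ 0
minBlock-∷-≡ x xs rewrite ≡ᵇ-refl x = refl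

minBlock-∷-≢ : ∀ {m x j} (xs : Vec ℕ m) → x ≢ j → minBlock (x ∷ xs) j ≡ suc (minBlock xs j)
minBlock-∷-≢ xs x≢j rewrite ≢⇒≡ᵇ-false x≢j = refl

≤⇒≤ᵇ-true : ∀ {m n} → m ≤ n → (m ≤ᵇ n) ≡ true
≤⇒≤ᵇ-true {m} {n} = dec-true (m ≤? n)

>⇒≤ᵇ-false : ∀ {m n} → n < m → (m ≤ᵇ n) ≡ false
>⇒≤ᵇ-false {m} {n} n<m = dec-false (m ≤? n) (ℕₚ.<⇒≱ n<m)

nBlocksFrom-≥ : ∀ {m} c (xs : Vec ℕ m) → c ≤ nBlocksFrom c xs
nBlocksFrom-≥ c []       = ℕₚ.≤-refl
nBlocksFrom-≥ c (x ∷ xs) with x ≡ᵇ c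
... | true  = ℕₚ.≤-trans (ℕₚ.n≤1+n c) (nBlocksFrom-≥ (suc c) xs)
... | false = nBlocksFrom-≥ c xs

-- In state c (blocks 0, …, c ∸ 1 open) the letter x contributes the c ∸ suc x triples of lb whose
-- third entry is the current position: one for each block opened after block x.
lbFrom : ∀ {m} → ℕ → Vec ℕ m → ℕ
lbFrom c []       = 0
lbFrom c (x ∷ xs) = c ∸ suc x + lbFrom (if x ≡ᵇ c then suc c else c) xs

module LbFormula where

  open FiniteSums ℕₚ.+-*-semiring
  open ≡-Reasoning

  ⟦_⟧ : ∀ {p} {P : Set p} → Dec P → ℕ
  ⟦ P? ⟧ = if does P? then 1 else 0

  ⟦⟧-no : ∀ {p} {P : Set p} (P? : Dec P) → ¬ P → ⟦ P? ⟧ ≡ 0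
  ⟦⟧-no P? ¬p = cong (λ d → if d then 1 else 0) (dec-false P? ¬p)

  ⟦⟧-⇔ : ∀ {p q} {P : Set p} {Q : Set q} → P ⇔ Q → (P? : Dec P) (Q? : Dec Q) → ⟦ P? ⟧ ≡ ⟦ Q? ⟧
  ⟦⟧-⇔ P⇔Q P? Q? = cong (λ d → if d then 1 else 0) (does-⇔ P⇔Q P? Q?)

  ∑-⟦×-dec⟧ : ∀ {A : Set} {p q} {P : Set p} {Q : A → Set q} (P? : Dec P) (Q? : ∀ y → Dec (Q y)) xs →
              ∑[ y ∈ xs ] ⟦ P? ×-dec Q? y ⟧ ≡ (if does P? then ∑[ y ∈ xs ] ⟦ Q? y ⟧ else 0)
  ∑-⟦×-dec⟧ (yes _) Q? xs = refl
  ∑-⟦×-dec⟧ (no _)  Q? xs = ∑-zero xs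

  length-filter : ∀ {A : Set} {p} {P : Pred A p} (P? : Decidable P) xs →
                  length (filter P? xs) ≡ ∑[ x ∈ xs ] ⟦ P? x ⟧
  length-filter P? []       = refl
  length-filter P? (x ∷ xs) with does (P? x)
  ... | true  = cong suc (length-filter P? xs)
  ... | false = length-filter P? xs

  length-filter-triples : ∀ {A B C : Set} {p} {P : Pred (A × B × C) p} (P? : Decidable P) xs ys zs →
    length (filter P? (concatMap (λ x → concatMap (λ y → map (λ z → x , y , z) zs) ys) xs))
      ≡ ∑[ x ∈ xs ] ∑[ y ∈ ys ] ∑[ z ∈ zs ] ⟦ P? (x , y , z) ⟧
  length-filter-triples {A} {B} {C} P? xs ys zs = begin
    length (filter P? (concatMap triplesFrom xs))
      ≡⟨ length-filter P? (concatMap triplesFrom xs) ⟩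
    ∑[ t ∈ concatMap triplesFrom xs ] ⟦ P? t ⟧
      ≡⟨ ∑-concatMap triplesFrom xs ⟩
    ∑[ x ∈ xs ] ∑[ t ∈ triplesFrom x ] ⟦ P? t ⟧
      ≡⟨ ∑-cong xs (λ x → ∑-concatMap (pairsFrom x) ys) ⟩
    ∑[ x ∈ xs ] ∑[ y ∈ ys ] ∑[ t ∈ pairsFrom x y ] ⟦ P? t ⟧
      ≡⟨ ∑-cong xs (λ x → ∑-cong ys (λ y → ∑-map (λ z → x , y , z) zs)) ⟩
    ∑[ x ∈ xs ] ∑[ y ∈ ys ] ∑[ z ∈ zs ] ⟦ P? (x , y , z) ⟧
      ∎
    where
    pairsFrom : A → B → List (A × B × C)
    pairsFrom x y = map (λ z → x , y , z) zs
    triplesFrom : A → List (A × B × C)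
    triplesFrom x = concatMap (pairsFrom x) ys

  count-above : ∀ x c → ∑[ j ∈ upTo c ] ⟦ x <? j ⟧ ≡ c ∸ suc x
  count-above x zero    = refl
  count-above x (suc c) = begin
    ∑[ j ∈ upTo (suc c) ] ⟦ x <? j ⟧        ≡⟨ ∑-upTo-∷ʳ c (λ j → ⟦ x <? j ⟧) ⟩
    ∑[ j ∈ upTo c ] ⟦ x <? j ⟧ + ⟦ x <? c ⟧ ≡⟨ cong (_+ ⟦ x <? c ⟧) (count-above x c) ⟩
    c ∸ suc x + ⟦ x <? c ⟧                 ≡⟨ add-last (x <? c) ⟩
    c ∸ x                                  ∎
    where
    add-last : (x<c? : Dec (x < c)) → c ∸ suc x + ⟦ x<c? ⟧ ≡ c ∸ x
    add-last (yes x<c) = trans (ℕₚ.+-comm _ 1) (sym (ℕₚ.+-∸-assoc 1 x<c))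
    add-last (no x≮c)  = begin
      c ∸ suc x + 0 ≡⟨ ℕₚ.+-identityʳ _ ⟩
      c ∸ suc x     ≡⟨ ℕₚ.m≤n⇒m∸n≡0 (ℕₚ.≤-trans c≤x (ℕₚ.n≤1+n x)) ⟩
      0             ≡⟨ sym (ℕₚ.m≤n⇒m∸n≡0 c≤x) ⟩
      c ∸ x         ∎
      where
      c≤x : c ≤ x
      c≤x = ℕₚ.≮⇒≥ x≮c

  count-between : ∀ {x c J} → c ≤ J → ∑[ j ∈ upTo J ] ⟦ (x <? j) ×-dec (j <? c) ⟧ ≡ c ∸ suc x
  count-between {x} {c} {J} c≤J = begin
    ∑[ j ∈ upTo J ] ⟦ between j ⟧
      ≡⟨ ∑-upTo-vanishing (λ j → ⟦ between j ⟧) c≤J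
           (λ {j} c≤j _ → ⟦⟧-no (between j) (λ (_ , j<c) → ℕₚ.<⇒≱ j<c c≤j)) ⟩
    ∑[ j ∈ upTo c ] ⟦ between j ⟧
      ≡⟨ ∑-cong-∈ (upTo c) (λ {j} j∈c → ⟦⟧-⇔ (mk⇔ proj₁ (_, ∈-upTo⁻ j∈c)) (between j) (x <? j)) ⟩
    ∑[ j ∈ upTo c ] ⟦ x <? j ⟧
      ≡⟨ count-above x c ⟩
    c ∸ suc x
      ∎
    where
    between : ∀ j → Dec (x < j × j < c)
    between j = (x <? j) ×-dec (j <? c)

  positionSum : ∀ {m} → (ℕ → ℕ → ℕ) → ℕ → Vec ℕ m → ℕ
  positionSum s off []       = 0
  positionSum s off (x ∷ xs) = s x off + positionSum s (suc off) xs

  ∑-positions : ∀ {m} (s : ℕ → ℕ → ℕ) off (xs : Vec ℕ m) →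
                ∑[ k ∈ allFin m ] s (lookup xs k) (off + toℕ k) ≡ positionSum s off xs
  ∑-positions s off []                 = refl
  ∑-positions {suc m} s off (x ∷ xs) = cong₂ _+_ (cong (s x) (ℕₚ.+-identityʳ off)) (begin
    ∑ (tabulate Fin.suc) g
      ≡⟨ cong (λ ks → ∑ ks g) (sym (map-tabulate id Fin.suc)) ⟩
    ∑ (map Fin.suc (allFin m)) g
      ≡⟨ ∑-map Fin.suc (allFin m) ⟩
    ∑[ k ∈ allFin m ] s (lookup xs k) (off + suc (toℕ k))
      ≡⟨ ∑-cong (allFin m) (λ k → cong (s _) (ℕₚ.+-suc off (toℕ k))) ⟩
    ∑[ k ∈ allFin m ] s (lookup xs k) (suc off + toℕ k)
      ≡⟨ ∑-positions s (suc off) xs ⟩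
    positionSum s (suc off) xs ∎)
    where
    g : Fin (suc m) → ℕ
    g k = s (lookup (x ∷ xs) k) (off + toℕ k)

  module Crossings {n} (w : Vec ℕ n) where

    private
      J : ℕ
      J = nBlocks w
      first : ℕ → ℕ
      first = minBlock w

    crossings : ℕ → ℕ → ℕ
    crossings x t = ∑[ j₁ ∈ upTo J ] ∑[ j₂ ∈ upTo J ]
                      ⟦ (x ≟ j₁) ×-dec ((first j₁ <? first j₂) ×-dec (first j₂ <? t)) ⟧

    lb≡∑crossings : (p : T (isRGF w)) → lb (w , p) ≡ ∑[ k ∈ allFin n ] crossings (lookup w k) (toℕ k)
    lb≡∑crossings p = begin
      lb (w , p)
        ≡⟨ length-filter-triples _ (upTo J) (upTo J) (allFin n) ⟩
      ∑[ j₁ ∈ upTo J ] ∑[ j₂ ∈ upTo J ] ∑[ k ∈ allFin n ] D j₁ j₂ k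
        ≡⟨ ∑-cong (upTo J) (λ j₁ → ∑-comm (upTo J) (allFin n) (D j₁)) ⟩
      ∑[ j₁ ∈ upTo J ] ∑[ k ∈ allFin n ] ∑[ j₂ ∈ upTo J ] D j₁ j₂ k
        ≡⟨ ∑-comm (upTo J) (allFin n) (λ j₁ k → ∑[ j₂ ∈ upTo J ] D j₁ j₂ k) ⟩
      ∑[ k ∈ allFin n ] crossings (lookup w k) (toℕ k)
        ∎
      where
      D : ℕ → ℕ → Fin n → ℕ
      D j₁ j₂ k = ⟦ (lookup w k ≟ j₁) ×-dec ((first j₁ <? first j₂) ×-dec (first j₂ <? toℕ k)) ⟧

    -- The situation after reading the first off letters of w, which opened the blocks 0, …, c ∸ 1;
    -- xs is the rest of w.
    record Tracks {m} (c off : ℕ) (xs : Vec ℕ m) : Set where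
      field
        opened-before : ∀ {j} → j < c → first j < off
        opened-later  : ∀ {j} → c ≤ j → j < J → first j ≡ off + minBlock xs j
        increasing    : ∀ {i j} → i < j → j < c → first i < first j

    tracks-start : Tracks 0 0 w
    tracks-start = record { opened-before = λ (); opened-later = λ _ _ → refl; increasing = λ _ () }

    module _ {m c off} {xs : Vec ℕ m} (tr : Tracks c off xs) where
      open Tracks tr

      off≤first : ∀ {j} → c ≤ j → j < J → off ≤ first j
      off≤first c≤j j<J = ℕₚ.≤-trans (ℕₚ.m≤m+n off _) (ℕₚ.≤-reflexive (sym (opened-later c≤j j<J)))

      opened⇔ : ∀ {j} → j < J → first j < off ⇔ j < c
      opened⇔ j<J =
        mk⇔ (λ fj<off → ℕₚ.≰⇒> (λ c≤j → ℕₚ.<⇒≱ fj<off (off≤first c≤j j<J))) opened-before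

      increasing-≤ : ∀ {i j} → i < j → j ≤ c → j < J → first i < first j
      increasing-≤ i<j j≤c j<J with ℕₚ.m≤n⇒m<n∨m≡n j≤c
      ... | inj₁ j<c  = increasing i<j j<c
      ... | inj₂ refl = ℕₚ.<-≤-trans (opened-before i<j) (off≤first ℕₚ.≤-refl j<J)

      first-reflects-< : ∀ {i j} → i ≤ c → i < J → j ≤ c → first i < first j → i < j
      first-reflects-< {i} {j} i≤c i<J j≤c fi<fj with ℕₚ.<-cmp i j
      ... | tri< i<j _ _ = i<j
      ... | tri≈ _ refl _ = ⊥-elim (ℕₚ.<-irrefl refl fi<fj)
      ... | tri> _ _ j<i = ⊥-elim (ℕₚ.<-asym fi<fj (increasing-≤ j<i i≤c i<J))

      crossing⇔ : ∀ {x j} → x ≤ c → x < J → j < J →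
                  (first x < first j × first j < off) ⇔ (x < j × j < c)
      crossing⇔ x≤c x<J j<J = mk⇔
        (λ (fx<fj , fj<off) → let j<c = Equivalence.to (opened⇔ j<J) fj<off in
                              first-reflects-< x≤c x<J (ℕₚ.<⇒≤ j<c) fx<fj , j<c)
        (λ (x<j , j<c) → increasing-≤ x<j (ℕₚ.<⇒≤ j<c) j<J , opened-before j<c)

      crossings-at : ∀ {x} → x ≤ c → x < J → c ≤ J → crossings x off ≡ c ∸ suc x
      crossings-at {x} x≤c x<J c≤J = begin
        crossings x off
          ≡⟨ ∑-cong (upTo J) (λ j₁ → ∑-⟦×-dec⟧ (x ≟ j₁) (later j₁) (upTo J)) ⟩
        ∑[ j₁ ∈ upTo J ] (if does (x ≟ j₁) then ∑[ j ∈ upTo J ] ⟦ later j₁ j ⟧ else 0)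
          ≡⟨ ∑-δ (λ j₁ → ∑[ j ∈ upTo J ] ⟦ later j₁ j ⟧) x<J ⟩
        ∑[ j ∈ upTo J ] ⟦ later x j ⟧
          ≡⟨ ∑-cong-∈ (upTo J) (λ {j} j∈J →
               ⟦⟧-⇔ (crossing⇔ x≤c x<J (∈-upTo⁻ j∈J)) (later x j) ((x <? j) ×-dec (j <? c))) ⟩
        ∑[ j ∈ upTo J ] ⟦ (x <? j) ×-dec (j <? c) ⟧
          ≡⟨ count-between c≤J ⟩
        c ∸ suc x
          ∎
        where
        later : ∀ i j → Dec (first i < first j × first j < off)
        later i j = (first i <? first j) ×-dec (first j <? off)

    first-after : ∀ {m c off x j} {xs : Vec ℕ m} → Tracks c off (x ∷ xs) → c ≤ j → j < J → x ≢ j →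
                  first j ≡ suc off + minBlock xs j
    first-after {off = off} {xs = xs} tr c≤j j<J x≢j =
      trans (Tracks.opened-later tr c≤j j<J) (trans (cong (_+_ off) (minBlock-∷-≢ xs x≢j)) (ℕₚ.+-suc off _))

    tracks-open : ∀ {m c off} {xs : Vec ℕ m} → Tracks c off (c ∷ xs) → c < J → Tracks (suc c) (suc off) xs
    tracks-open {c = c} {off} {xs} tr c<J = record
      { opened-before = before
      ; opened-later  = λ c<j j<J → first-after tr (ℕₚ.<⇒≤ c<j) j<J (ℕₚ.<⇒≢ c<j)
      ; increasing    = increasing′
      }
      where
      open Tracks tr
      first-c : first c ≡ off
      first-c = begin
        first c                   ≡⟨ opened-later ℕₚ.≤-refl c<J ⟩
        off + minBlock (c ∷ xs) c ≡⟨ cong (_+_ off) (minBlock-∷-≡ c xs) ⟩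
        off + 0                   ≡⟨ ℕₚ.+-identityʳ off ⟩
        off                       ∎
      before : ∀ {j} → j < suc c → first j < suc off
      before j<1+c with ℕₚ.m<1+n⇒m<n∨m≡n j<1+c
      ... | inj₁ j<c  = ℕₚ.m<n⇒m<1+n (opened-before j<c)
      ... | inj₂ refl = s≤s (ℕₚ.≤-reflexive first-c)
      increasing′ : ∀ {i j} → i < j → j < suc c → first i < first j
      increasing′ i<j j<1+c with ℕₚ.m<1+n⇒m<n∨m≡n j<1+c
      ... | inj₁ j<c  = increasing i<j j<c
      ... | inj₂ refl = subst (first _ <_) (sym first-c) (opened-before i<j)

    tracks-revisit : ∀ {m c off x} {xs : Vec ℕ m} → Tracks c off (x ∷ xs) → x < c → Tracks c (suc off) xs
    tracks-revisit tr x<c = record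
      { opened-before = ℕₚ.m<n⇒m<1+n ∘ opened-before
      ; opened-later  = λ c≤j j<J → first-after tr c≤j j<J (ℕₚ.<⇒≢ (ℕₚ.<-≤-trans x<c c≤j))
      ; increasing    = increasing
      }
      where open Tracks tr

    crossings-from : ∀ {m} c off (xs : Vec ℕ m) → T (rgfFrom c xs) → nBlocksFrom c xs ≡ J →
                     Tracks c off xs → positionSum crossings off xs ≡ lbFrom c xs
    crossings-from c off []       _   _  _  = refl
    crossings-from c off (x ∷ xs) rgf nb tr with Equivalence.to T-∧ rgf
    ... | x≤ᵇc , rgf′ with ℕₚ.m≤n⇒m<n∨m≡n (ℕₚ.≤ᵇ⇒≤ x c x≤ᵇc)
    ...   | inj₁ x<c rewrite ≢⇒≡ᵇ-false (ℕₚ.<⇒≢ x<c) =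
      cong₂ _+_ (crossings-at tr (ℕₚ.<⇒≤ x<c) (ℕₚ.<-≤-trans x<c c≤J) c≤J)
                (crossings-from c (suc off) xs rgf′ nb (tracks-revisit tr x<c))
      where
      c≤J : c ≤ J
      c≤J = subst (c ≤_) nb (nBlocksFrom-≥ c xs)
    ...   | inj₂ refl rewrite ≡ᵇ-refl x =
      cong₂ _+_ (crossings-at tr ℕₚ.≤-refl x<J (ℕₚ.<⇒≤ x<J))
                (crossings-from (suc x) (suc off) xs rgf′ nb (tracks-open tr x<J))
      where
      x<J : x < J
      x<J = subst (suc x ≤_) nb (nBlocksFrom-≥ (suc x) xs)

  lb≡lbFrom : ∀ {n} (w : Vec ℕ n) (p : T (isRGF w)) → lb (w , p) ≡ lbFrom 0 w
  lb≡lbFrom {n} w p = begin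
    lb (w , p)                                       ≡⟨ lb≡∑crossings p ⟩
    ∑[ k ∈ allFin n ] crossings (lookup w k) (toℕ k) ≡⟨ ∑-positions crossings 0 w ⟩
    positionSum crossings 0 w                        ≡⟨ crossings-from 0 0 w p refl tracks-start ⟩
    lbFrom 0 w                                       ∎
    where open Crossings w

open FiniteSums ℤₚ.+-*-semiring
open ≡-Reasoning

sign : ℕ → ℤ
sign k = -1ℤ ^ k

odd : ℕ → Bool
odd zero    = false
odd (suc n) = not (odd n)

sign-odd : ∀ k → sign k ≡ (if odd k then -1ℤ else 1ℤ)
sign-odd zero    = refl
sign-odd (suc k) rewrite sign-odd k with odd k
... | true  = refl
... | false = refl

alternating : ℕ → ℤ
alternating c = ∑[ x ∈ upTo c ] sign (c ∸ suc x)

alternating-odd : ∀ c → alternating c ≡ (if odd c then 1ℤ else 0ℤ)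
alternating-odd zero    = refl
alternating-odd (suc c) rewrite ∑-upTo-suc c (λ x → sign (suc c ∸ suc x)) | sign-odd c | alternating-odd c
  with odd c
... | true  = refl
... | false = refl

∑-1 : ∀ {A : Set} (xs : List A) → ∑[ _ ∈ xs ] 1ℤ ≡ + length xs
∑-1 []       = refl
∑-1 (_ ∷ xs) = cong (ℤ._+_ 1ℤ) (∑-1 xs)

weight : ∀ {m} → ℕ → Vec ℕ m → ℤ
weight c xs = if rgfFrom c xs then sign (lbFrom c xs) else 0ℤ

weight-rgf : ∀ {m c} {xs : Vec ℕ m} → T (rgfFrom c xs) → weight c xs ≡ sign (lbFrom c xs)
weight-rgf {c = c} {xs} rgf with rgfFrom c xs
... | true = refl

weight-¬rgf : ∀ {m c} {xs : Vec ℕ m} → ¬ T (rgfFrom c xs) → weight c xs ≡ 0ℤ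
weight-¬rgf {c = c} {xs} ¬rgf with rgfFrom c xs
... | true  = ⊥-elim (¬rgf _)
... | false = refl

weight-revisit : ∀ {m c x} (xs : Vec ℕ m) → x < c → weight c (x ∷ xs) ≡ sign (c ∸ suc x) * weight c xs
weight-revisit {c = c} {x} xs x<c
  rewrite ≤⇒≤ᵇ-true (ℕₚ.<⇒≤ x<c) | ≢⇒≡ᵇ-false (ℕₚ.<⇒≢ x<c)
  with rgfFrom c xs
... | true  = ℤₚ.^-distribˡ-+-* -1ℤ (c ∸ suc x) (lbFrom c xs)
... | false = sym (ℤₚ.*-zeroʳ (sign (c ∸ suc x)))

weight-open : ∀ {m c} (xs : Vec ℕ m) → weight c (c ∷ xs) ≡ weight (suc c) xs
weight-open {c = c} xs
  rewrite ≤⇒≤ᵇ-true (ℕₚ.≤-refl {c}) | ≡ᵇ-refl c | ℕₚ.m≤n⇒m∸n≡0 (ℕₚ.n≤1+n c) = refl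

weight-beyond : ∀ {m c x} (xs : Vec ℕ m) → c < x → weight c (x ∷ xs) ≡ 0ℤ
weight-beyond xs c<x rewrite >⇒≤ᵇ-false c<x = refl

signedContinuations : (B c m : ℕ) → ℤ
signedContinuations B c m = ∑[ v ∈ allWords m B ] weight c v

signedContinuations-suc : ∀ {B c} m → c < B →
  signedContinuations B c (suc m)
    ≡ alternating c * signedContinuations B c m ℤ.+ signedContinuations B (suc c) m
signedContinuations-suc {B} {c} m c<B = begin
  ∑ (concatMap (λ x → map (x ∷_) W) (upTo B)) (weight c)
    ≡⟨ ∑-concatMap {g = weight c} (λ x → map (x ∷_) W) (upTo B) ⟩
  ∑[ x ∈ upTo B ] ∑ (map (x ∷_) W) (weight c)
    ≡⟨ ∑-cong (upTo B) (λ x → ∑-map {g = weight c} (x ∷_) W) ⟩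
  ∑[ x ∈ upTo B ] F x
    ≡⟨ ∑-upTo-vanishing F c<B F-beyond ⟩
  ∑[ x ∈ upTo (suc c) ] F x
    ≡⟨ ∑-upTo-∷ʳ c F ⟩
  ∑[ x ∈ upTo c ] F x ℤ.+ F c
    ≡⟨ cong₂ ℤ._+_ (∑-cong-∈ (upTo c) (F-revisit ∘ ∈-upTo⁻)) (∑-cong W weight-open) ⟩
  ∑[ x ∈ upTo c ] (sign (c ∸ suc x) * S c) ℤ.+ S (suc c)
    ≡⟨ cong (λ s → s ℤ.+ S (suc c)) (sym (*-distribʳ-∑ {g = λ x → sign (c ∸ suc x)} (S c) (upTo c))) ⟩
  alternating c * S c ℤ.+ S (suc c)
    ∎
  where
  W : List (Vec ℕ m)
  W = allWords m B
  S : ℕ → ℤ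
  S c′ = signedContinuations B c′ m
  F : ℕ → ℤ
  F x = ∑[ v ∈ W ] weight c (x ∷ v)
  F-beyond : ∀ {x} → suc c ≤ x → x < B → F x ≡ 0ℤ
  F-beyond c<x _ = trans (∑-cong W (λ v → weight-beyond v c<x)) (∑-zero W)
  F-revisit : ∀ {x} → x < c → F x ≡ sign (c ∸ suc x) * S c
  F-revisit {x} x<c =
    trans (∑-cong W (λ v → weight-revisit v x<c)) (sym (*-distribˡ-∑ {g = weight c} (sign (c ∸ suc x)) W))

bShifted : ℕ → ℕ → ℕ
bShifted c m = if odd c then b (suc m) else b m

bShifted-recurrence : ∀ c m →
  (if odd c then 1ℤ else 0ℤ) * + bShifted c m ℤ.+ + bShifted (suc c) m ≡ + bShifted c (suc m)
bShifted-recurrence c m with odd c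
... | true  = cong (λ s → s ℤ.+ + b m) (ℤₚ.*-identityˡ (+ b (suc m)))
... | false = refl

signedContinuations-closed : ∀ {B} m c → c + m ≤ B → signedContinuations B c m ≡ + bShifted c m
signedContinuations-closed zero c _ with odd c
... | true  = refl
... | false = refl
signedContinuations-closed {B} (suc m) c c+1+m≤B = begin
  signedContinuations B c (suc m)
    ≡⟨ signedContinuations-suc m c<B ⟩
  alternating c * signedContinuations B c m ℤ.+ signedContinuations B (suc c) m
    ≡⟨ cong₂ ℤ._+_ (cong₂ _*_ (alternating-odd c) (signedContinuations-closed m c c+m≤B))
                   (signedContinuations-closed m (suc c) 1+c+m≤B) ⟩
  (if odd c then 1ℤ else 0ℤ) * + bShifted c m ℤ.+ + bShifted (suc c) m
    ≡⟨ bShifted-recurrence c m ⟩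
  + bShifted c (suc m)
    ∎
  where
  c<B : c < B
  c<B = ℕₚ.<-≤-trans (ℕₚ.m<m+n c z<s) c+1+m≤B
  c+m≤B : c + m ≤ B
  c+m≤B = ℕₚ.≤-trans (ℕₚ.+-monoʳ-≤ c (ℕₚ.n≤1+n m)) c+1+m≤B
  1+c+m≤B : suc c + m ≤ B
  1+c+m≤B = ℕₚ.≤-trans (ℕₚ.≤-reflexive (sym (ℕₚ.+-suc c m))) c+1+m≤B

weight-toSP : ∀ {n} (w : Vec ℕ n) → maybe′ (λ π → sign (lb π)) 0ℤ (toSP w) ≡ weight 0 w
weight-toSP w with T? (isRGF w)
... | yes p  = trans (cong sign (LbFormula.lb≡lbFrom w p)) (sym (weight-rgf {xs = w} p))
... | no ¬p  = sym (weight-¬rgf {xs = w} ¬p)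

∑-sign-lb : ∀ n → ∑[ π ∈ Π n ] sign (lb π) ≡ + b n
∑-sign-lb n = begin
  ∑[ π ∈ Π n ] sign (lb π)
    ≡⟨ ∑-mapMaybe toSP (allWords n n) ⟩
  ∑[ w ∈ allWords n n ] maybe′ (λ π → sign (lb π)) 0ℤ (toSP w)
    ≡⟨ ∑-cong (allWords n n) weight-toSP ⟩
  signedContinuations n 0 n
    ≡⟨ signedContinuations-closed n 0 ℕₚ.≤-refl ⟩
  + b n
    ∎

-- The CSP for the group {id, φ} only involves the number of fixed points of φ.
theorem4p5 : (stat : Statistic) → EquidistributedWithLb stat →
    (n : ℕ) → (φ : SetPartition n → SetPartition n) → IsInvolution φ →
    numFixedPoints φ ≡ b n → CSP-involution φ stat
theorem4p5 stat equidistributed n φ _ fixedPoints = at-one , at-minus-one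
  where
  at-one : genFunEval {n} stat 1ℤ ≡ + length (Π n)
  at-one = trans (∑-cong (Π n) (λ π → ℤₚ.^-zeroˡ (stat π))) (∑-1 (Π n))
  at-minus-one : genFunEval {n} stat -1ℤ ≡ + numFixedPoints φ
  at-minus-one = begin
    genFunEval {n} stat -1ℤ    ≡⟨⟩
    ∑[ π ∈ Π n ] sign (stat π) ≡⟨ ∑-equidistributed (Π n) stat lb sign (equidistributed n) ⟩
    ∑[ π ∈ Π n ] sign (lb π)   ≡⟨ ∑-sign-lb n ⟩
    + b n                      ≡⟨ cong +_ (sym fixedPoints) ⟩
    + numFixedPoints φ         ∎
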